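{- Let $f(i,j)=i^3+2i^2j+2ij^2+j^3$ and $g(i,j)=i^3-2i^2j+2ij^2-j^3$, and consider the system $$f(i,0)\,u_{i,j}=f(i,j)\,u_{i-1,j}+g(0,j)\,u_{i-1,j-1},\qquad f(i,0)\,u_{i,j-1}=f(0,j)\,u_{i-1,j}+g(i,j)\,u_{i-1,j-1}\qquad(i,j\ge1)$$ for a family $(u_{i,j})_{i,j\ge0}$. Then for any solution $u$ of this system and all $i,j\ge 1$, $u_{i,j}$ is a $\mathbb{Z}$-linear combination of $u_{i-1,j}$, $u_{i,j-1}$ and $u_{i-1,j-1}$ (i.e. $u_{i,j}=a\,u_{i-1,j}+b\,u_{i,j-1}+c\,u_{i-1,j-1}$ for some integers $a,b,c$ depending only on $i,j$). Consequently, if $q_{i,j}$ denotes the rational solution with $q_{0,j}=q_{i,0}=1$ for all $i,j\ge0$, and $p_{i,j}$ denotes the rational solution with $p_{0,0}=0$ and $p_{0,j}=\sum_{n=1}^j n^{ -3}$, $p_{i,0}=\sum_{n=1}^i n^{ -3}$ for $i,j\ge1$, then for all $i,j\ge 0$ the numbers $q_{i,j}$ and $d_{\max(i,j)}^3\,p_{i,j}$ are integers, where $d_n=\operatorname{lcm}(1,2,\ldots,n)$ (with $d_0=1$).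
   Context: Rational-valued solutions $q$ and $p$ with the stated boundary values exist (they are uniquely determined by the boundary values and the first equation of the system). -}

module Defs where

open import Data.Nat as ℕ using (ℕ; zero; suc)
open import Data.Nat.LCM using (lcm)
open import Data.Integer as ℤ using (ℤ; +_)
open import Data.Rational using (ℚ; _+_; _*_; _-_; _/_; 0ℚ; 1ℚ)
open import Data.Product using (∃)
open import Relation.Binary.PropositionalEquality using (_≡_)

ι : ℕ → ℚ
ι n = (+ n) / 1

cube : ℚ → ℚ
cube x = x * x * x

f : ℕ → ℕ → ℚ
f i j = cube (ι i) + ι 2 * ι i * ι i * ι j + ι 2 * ι i * ι j * ι j + cube (ι j)

g : ℕ → ℕ → ℚ
g i j = cube (ι i) - ι 2 * ι i * ι i * ι j + ι 2 * ι i * ι j * ι j - cube (ι j)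

Solves : (ℕ → ℕ → ℚ) → Set
Solves u = ∀ i j →
  (f (suc i) 0 * u (suc i) (suc j) ≡ f (suc i) (suc j) * u i (suc j) + g 0 (suc j) * u i j)
  Data.Product.× (f (suc i) 0 * u (suc i) j ≡ f 0 (suc j) * u i (suc j) + g (suc i) (suc j) * u i j)

H3 : ℕ → ℚ
H3 zero = 0ℚ
H3 (suc n) = H3 n + (+ 1) / (suc n ℕ.^ 3)

d : ℕ → ℕ
d zero = 1
d (suc n) = lcm (suc n) (d n)

IsInteger : ℚ → Set
IsInteger x = ∃ λ (z : ℤ) → x ≡ z / 1

module Submission where

-- Put F = f(i,0) = i³ and P = f(0,j) = j³. If integers a, b, c satisfy a F + b P = f(i,j) and
-- c F + b g(i,j) = g(0,j), then the first equation of the system reads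
-- F u_{i,j} = F (a u_{i-1,j} + c u_{i-1,j-1}) + b (P u_{i-1,j} + g(i,j) u_{i-1,j-1}), and the second
-- turns the last bracket into F u_{i,j-1}; dividing by F gives u_{i,j} = a u_{i-1,j} + b u_{i,j-1} + c u_{i-1,j-1}.
-- Both forms are homogeneous of degree 3, so such a, b, c for i/gcd(i,j), j/gcd(i,j) also serve for i, j.
-- For coprime i, j choose x i³ + y j³ = 1; then a = x f(i,j), b = y f(i,j), c = -(x j³ + y i³) work,
-- because f(i,j) g(i,j) = i⁶ - j⁶.
-- Integrality of q and of d_{max(i,j)}³ p then follows by induction on (i, j): the scaling factor only
-- grows by divisibility, and d_n³ (1 + 2⁻³ + … + n⁻³) is an integer since k³ ∣ d_n³ for k ≤ n.

open import Defs
open import Data.Integer as ℤ using (ℤ; +_; +[1+_]; -[1+_]; 0ℤ)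
open import Data.List using (_∷_; [])
open import Data.Maybe using (nothing)
open import Data.Product using (_×_; _,_; proj₁; proj₂; ∃-syntax)
open import Data.Nat as ℕ using (ℕ; zero; suc; _⊔_; _≤_; _≤′_; ≤′-refl; ≤′-step)
open import Data.Nat.Properties using (≤⇒≤′; n≤1+n; ≤-refl; ⊔-mono-≤)
open import Data.Nat.Divisibility using (_∣_; divides; ∣-refl; ∣-trans; *-pres-∣)
open import Data.Nat.DivMod using (m/n*n≡m) renaming (_/_ to _div_)
open import Data.Nat.GCD using (gcd; gcd[m,n]∣m; gcd[m,n]∣n; gcd[m,n]≢0; module Bézout)
open import Data.Nat.Coprimality as Coprimality using (Coprime; coprime-Bézout; coprime-/gcd; 1-coprimeTo)
open import Data.Nat.LCM using (m∣lcm[m,n]; n∣lcm[m,n])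
open import Data.Sum using (inj₁)
import Data.Integer.Properties as ℤP
import Data.Rational.Properties as ℚP
open import Level using (0ℓ)
import Tactic.RingSolver as RingSolver
open import Tactic.RingSolver.Core.AlmostCommutativeRing using (AlmostCommutativeRing; fromCommutativeRing)
open import Relation.Binary.PropositionalEquality
  using (_≡_; refl; sym; trans; cong; cong₂; subst; subst₂; module ≡-Reasoning)

open ≡-Reasoning

module CubicForms where

  open import Data.Integer using (-_; _+_; _-_; _*_; 1ℤ)
  open import Data.Integer.Tactic.RingSolver using (solve-∀; solve; ring)
  open AlmostCommutativeRing ring using (_^_)

  -- INLINE lets the ring solver see through these definitions.
  cubeℤ : ℤ → ℤ
  cubeℤ x = x * x * x
  {-# INLINE cubeℤ #-}

  fℤ : ℤ → ℤ → ℤ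
  fℤ i j = cubeℤ i + + 2 * i * i * j + + 2 * i * j * j + cubeℤ j
  {-# INLINE fℤ #-}

  gℤ : ℤ → ℤ → ℤ
  gℤ i j = cubeℤ i - + 2 * i * i * j + + 2 * i * j * j - cubeℤ j
  {-# INLINE gℤ #-}

  fℤ-[i,0] : ∀ i → fℤ i 0ℤ ≡ cubeℤ i
  fℤ-[i,0] = solve-∀

  fℤ-[0,j] : ∀ j → fℤ 0ℤ j ≡ cubeℤ j
  fℤ-[0,j] = solve-∀

  gℤ-[0,j] : ∀ j → gℤ 0ℤ j ≡ - cubeℤ j
  gℤ-[0,j] = solve-∀

  fℤ-homogeneous : ∀ k i j → fℤ (i * k) (j * k) ≡ cubeℤ k * fℤ i j
  fℤ-homogeneous = solve-∀

  gℤ-homogeneous : ∀ k i j → gℤ (i * k) (j * k) ≡ cubeℤ k * gℤ i j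
  gℤ-homogeneous = solve-∀

  fℤ*gℤ : ∀ i j → fℤ i j * gℤ i j ≡ cubeℤ i * cubeℤ i - cubeℤ j * cubeℤ j
  fℤ*gℤ = solve-∀

  Bézout : ℤ → ℤ → Set
  Bézout i j = ∃[ x ] ∃[ y ] x * i + y * j ≡ 1ℤ

  EliminationCoefficients : ℤ → ℤ → Set
  EliminationCoefficients i j = ∃[ a ] ∃[ b ] ∃[ c ]
    (a * fℤ i 0ℤ + b * fℤ 0ℤ j ≡ fℤ i j) × (c * fℤ i 0ℤ + b * gℤ i j ≡ gℤ 0ℤ j)

  homogeneous-combination : ∀ k p q r {p′ q′ r′} a b → p′ ≡ k * p → q′ ≡ k * q → r′ ≡ k * r →
                            a * p + b * q ≡ r → a * p′ + b * q′ ≡ r′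
  homogeneous-combination k p q r {p′} {q′} {r′} a b p′≡kp q′≡kq r′≡kr eq = begin
    a * p′ + b * q′             ≡⟨ cong₂ (λ s t → a * s + b * t) p′≡kp q′≡kq ⟩
    a * (k * p) + b * (k * q)   ≡⟨ solve (a ∷ b ∷ k ∷ p ∷ q ∷ []) ⟩
    k * (a * p + b * q)         ≡⟨ cong (k *_) eq ⟩
    k * r                       ≡⟨ r′≡kr ⟨
    r′                          ∎

  EliminationCoefficients-scale : ∀ k {i j} → EliminationCoefficients i j → EliminationCoefficients (i * k) (j * k)
  EliminationCoefficients-scale k {i} {j} (a , b , c , e₁ , e₂) =
    a , b , c ,
    homogeneous-combination (cubeℤ k) (fℤ i 0ℤ) (fℤ 0ℤ j) (fℤ i j) a b
      (fℤ-homogeneous k i 0ℤ) (fℤ-homogeneous k 0ℤ j) (fℤ-homogeneous k i j) e₁ ,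
    homogeneous-combination (cubeℤ k) (fℤ i 0ℤ) (gℤ i j) (gℤ 0ℤ j) c b
      (fℤ-homogeneous k i 0ℤ) (gℤ-homogeneous k i j) (gℤ-homogeneous k 0ℤ j) e₂

  Bézout-cubes⇒EliminationCoefficients : ∀ {i j} → Bézout (cubeℤ i) (cubeℤ j) → EliminationCoefficients i j
  Bézout-cubes⇒EliminationCoefficients {i} {j} (x , y , s≡1) =
    x * fℤ i j , y * fℤ i j , - (x * cubeℤ j + y * cubeℤ i) , first , second
    where
    s = x * cubeℤ i + y * cubeℤ j
    first : x * fℤ i j * fℤ i 0ℤ + y * fℤ i j * fℤ 0ℤ j ≡ fℤ i j
    first = begin
      x * fℤ i j * fℤ i 0ℤ + y * fℤ i j * fℤ 0ℤ j
        ≡⟨ cong₂ (λ p q → x * fℤ i j * p + y * fℤ i j * q) (fℤ-[i,0] i) (fℤ-[0,j] j) ⟩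
      x * fℤ i j * cubeℤ i + y * fℤ i j * cubeℤ j  ≡⟨ factor x y (fℤ i j) (cubeℤ i) (cubeℤ j) ⟩
      fℤ i j * s                                   ≡⟨ cong (fℤ i j *_) s≡1 ⟩
      fℤ i j * 1ℤ                                  ≡⟨ ℤP.*-identityʳ (fℤ i j) ⟩
      fℤ i j                                       ∎
      where
      factor : ∀ x y f p q → x * f * p + y * f * q ≡ f * (x * p + y * q)
      factor = solve-∀
    second : - (x * cubeℤ j + y * cubeℤ i) * fℤ i 0ℤ + y * fℤ i j * gℤ i j ≡ gℤ 0ℤ j
    second = begin
      - (x * cubeℤ j + y * cubeℤ i) * fℤ i 0ℤ + y * fℤ i j * gℤ i j
        ≡⟨ cong₂ (λ p t → - (x * cubeℤ j + y * cubeℤ i) * p + t) (fℤ-[i,0] i)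
                 (trans (ℤP.*-assoc y (fℤ i j) (gℤ i j)) (cong (y *_) (fℤ*gℤ i j))) ⟩
      - (x * cubeℤ j + y * cubeℤ i) * cubeℤ i + y * (cubeℤ i * cubeℤ i - cubeℤ j * cubeℤ j)
        ≡⟨ factor x y (cubeℤ i) (cubeℤ j) ⟩
      - cubeℤ j * s        ≡⟨ cong (- cubeℤ j *_) s≡1 ⟩
      - cubeℤ j * 1ℤ       ≡⟨ ℤP.*-identityʳ (- cubeℤ j) ⟩
      - cubeℤ j            ≡⟨ gℤ-[0,j] j ⟨
      gℤ 0ℤ j              ∎
      where
      factor : ∀ x y p q → - (x * q + y * p) * p + y * (p * p - q * q) ≡ - q * (x * p + y * q)
      factor = solve-∀

  -- In the binomial expansion of (X i + Y j)⁵ every term is divisible by i³ or by j³.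
  Bézout-cubes : ∀ {i j} → Bézout i j → Bézout (cubeℤ i) (cubeℤ j)
  Bézout-cubes {i} {j} (X , Y , eq) = x , y , (begin
    cubeℤ X * (X * X * i * i + + 5 * X * Y * i * j + + 10 * Y * Y * j * j) * cubeℤ i
      + cubeℤ Y * (Y * Y * j * j + + 5 * X * Y * i * j + + 10 * X * X * i * i) * cubeℤ j
                           ≡⟨ solve (X ∷ Y ∷ i ∷ j ∷ []) ⟩
    (X * i + Y * j) ^ 5    ≡⟨ cong (_^ 5) eq ⟩
    1ℤ                     ∎)
    where
    x = cubeℤ X * (X * X * i * i + + 5 * X * Y * i * j + + 10 * Y * Y * j * j)
    y = cubeℤ Y * (Y * Y * j * j + + 5 * X * Y * i * j + + 10 * X * X * i * i)

  1+bn≡am⇒Bézout : ∀ {a m b n} → 1 ℕ.+ b ℕ.* n ≡ a ℕ.* m → + a * + m + - + b * + n ≡ 1ℤ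
  1+bn≡am⇒Bézout {a} {m} {b} {n} eq = begin
    + a * + m + - + b * + n           ≡⟨ cong (λ t → t + - + b * + n) (ℤP.pos-* a m) ⟨
    + (a ℕ.* m) + - + b * + n         ≡⟨ cong (λ t → + t + - + b * + n) eq ⟨
    1ℤ + + (b ℕ.* n) + - + b * + n    ≡⟨ cong (λ t → 1ℤ + t + - + b * + n) (ℤP.pos-* b n) ⟩
    1ℤ + + b * + n + - + b * + n      ≡⟨ cancel (+ b) (+ n) ⟩
    1ℤ                                ∎
    where
    cancel : ∀ b n → 1ℤ + b * n + - b * n ≡ 1ℤ
    cancel = solve-∀

  coprime⇒Bézout : ∀ {m n} → Coprime m n → Bézout (+ m) (+ n)
  coprime⇒Bézout {m} {n} c with coprime-Bézout c
  ... | Bézout.+- x y eq = + x , - + y , 1+bn≡am⇒Bézout {x} {m} {y} {n} eq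
  ... | Bézout.-+ x y eq = - + x , + y , trans (ℤP.+-comm (- + x * + m) (+ y * + n)) (1+bn≡am⇒Bézout {y} {n} {x} {m} eq)

  gcd-nonZero : ∀ m n .{{_ : ℕ.NonZero m}} → ℕ.NonZero (gcd m n)
  gcd-nonZero m n = ℕ.≢-nonZero (gcd[m,n]≢0 m n (inj₁ (ℕ.≢-nonZero⁻¹ m)))

  eliminationCoefficients : ∀ m n .{{_ : ℕ.NonZero m}} → EliminationCoefficients (+ m) (+ n)
  eliminationCoefficients m n =
    subst₂ EliminationCoefficients (quotient*gcd (gcd[m,n]∣m m n)) (quotient*gcd (gcd[m,n]∣n m n))
      (EliminationCoefficients-scale (+ δ) {+ (m div δ)} {+ (n div δ)}
        (Bézout-cubes⇒EliminationCoefficients {+ (m div δ)} {+ (n div δ)}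
          (Bézout-cubes (coprime⇒Bézout (coprime-/gcd m n)))))
    where
    δ = gcd m n
    instance
      _ = gcd-nonZero m n
    quotient*gcd : ∀ {k} → δ ∣ k → + (k div δ) * + δ ≡ + k
    quotient*gcd {k} δ∣k = trans (sym (ℤP.pos-* (k div δ) δ)) (cong +_ (m/n*n≡m δ∣k))

open CubicForms using (cubeℤ; fℤ; gℤ; fℤ-[i,0]; eliminationCoefficients)

-- Opened only here: inside CubicForms these names denote the integer operations.
open import Data.Nat using (_^_)
open import Data.Rational using (ℚ; _+_; _*_; -_; _/_; 0ℚ; 1ℚ; mkℚ; NonZero; 1/_)

toℚ : ℤ → ℚ
toℚ z = z / 1

toℚ≡mkℚ : ∀ z → toℚ z ≡ mkℚ z 0 (Coprimality.sym (1-coprimeTo _))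
toℚ≡mkℚ z = ℚP.↥p/↧p≡p (mkℚ z 0 (Coprimality.sym (1-coprimeTo _)))

toℚ-+ : ∀ a b → toℚ (a ℤ.+ b) ≡ toℚ a + toℚ b
toℚ-+ a b rewrite toℚ≡mkℚ a | toℚ≡mkℚ b = cong toℚ (sym (cong₂ ℤ._+_ (ℤP.*-identityʳ a) (ℤP.*-identityʳ b)))

toℚ-* : ∀ a b → toℚ (a ℤ.* b) ≡ toℚ a * toℚ b
toℚ-* a b rewrite toℚ≡mkℚ a | toℚ≡mkℚ b = refl

toℚ-neg : ∀ a → toℚ (ℤ.- a) ≡ - toℚ a
toℚ-neg (+ zero) = refl
toℚ-neg +[1+ n ] rewrite toℚ≡mkℚ +[1+ n ] = refl
toℚ-neg -[1+ n ] rewrite toℚ≡mkℚ +[1+ n ] = refl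

toℚ-*³ : ∀ a b c → toℚ (a ℤ.* b ℤ.* c) ≡ toℚ a * toℚ b * toℚ c
toℚ-*³ a b c = trans (toℚ-* (a ℤ.* b) c) (cong (_* toℚ c) (toℚ-* a b))

toℚ-*⁴ : ∀ a b c e → toℚ (a ℤ.* b ℤ.* c ℤ.* e) ≡ toℚ a * toℚ b * toℚ c * toℚ e
toℚ-*⁴ a b c e = trans (toℚ-* (a ℤ.* b ℤ.* c) e) (cong (_* toℚ e) (toℚ-*³ a b c))

toℚ-fℤ : ∀ m n → toℚ (fℤ (+ m) (+ n)) ≡ f m n
toℚ-fℤ m n =
  trans (toℚ-+ (m³ ℤ.+ m²n ℤ.+ mn²) n³) (cong₂ _+_
    (trans (toℚ-+ (m³ ℤ.+ m²n) mn²) (cong₂ _+_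
      (trans (toℚ-+ m³ m²n) (cong₂ _+_ (toℚ-*³ (+ m) (+ m) (+ m)) (toℚ-*⁴ (+ 2) (+ m) (+ m) (+ n))))
      (toℚ-*⁴ (+ 2) (+ m) (+ n) (+ n))))
    (toℚ-*³ (+ n) (+ n) (+ n)))
  where
  m³  = cubeℤ (+ m)
  m²n = + 2 ℤ.* + m ℤ.* + m ℤ.* + n
  mn² = + 2 ℤ.* + m ℤ.* + n ℤ.* + n
  n³  = cubeℤ (+ n)

toℚ-gℤ : ∀ m n → toℚ (gℤ (+ m) (+ n)) ≡ g m n
toℚ-gℤ m n =
  trans (toℚ-+ (m³ ℤ.- m²n ℤ.+ mn²) (ℤ.- n³)) (cong₂ _+_
    (trans (toℚ-+ (m³ ℤ.- m²n) mn²) (cong₂ _+_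
      (trans (toℚ-+ m³ (ℤ.- m²n)) (cong₂ _+_ (toℚ-*³ (+ m) (+ m) (+ m))
        (trans (toℚ-neg m²n) (cong -_ (toℚ-*⁴ (+ 2) (+ m) (+ m) (+ n))))))
      (toℚ-*⁴ (+ 2) (+ m) (+ n) (+ n))))
    (trans (toℚ-neg n³) (cong -_ (toℚ-*³ (+ n) (+ n) (+ n)))))
  where
  m³  = cubeℤ (+ m)
  m²n = + 2 ℤ.* + m ℤ.* + m ℤ.* + n
  mn² = + 2 ℤ.* + m ℤ.* + n ℤ.* + n
  n³  = cubeℤ (+ n)

toℚ-combination : ∀ a b P Q R {p q r} → toℚ P ≡ p → toℚ Q ≡ q → toℚ R ≡ r →
                  a ℤ.* P ℤ.+ b ℤ.* Q ≡ R → toℚ a * p + toℚ b * q ≡ r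
toℚ-combination a b P Q R {p} {q} {r} P↦p Q↦q R↦r eq = begin
  toℚ a * p + toℚ b * q           ≡⟨ cong₂ (λ s t → toℚ a * s + toℚ b * t) P↦p Q↦q ⟨
  toℚ a * toℚ P + toℚ b * toℚ Q   ≡⟨ cong₂ _+_ (toℚ-* a P) (toℚ-* b Q) ⟨
  toℚ (a ℤ.* P) + toℚ (b ℤ.* Q)   ≡⟨ toℚ-+ (a ℤ.* P) (b ℤ.* Q) ⟨
  toℚ (a ℤ.* P ℤ.+ b ℤ.* Q)       ≡⟨ cong toℚ eq ⟩
  toℚ R                           ≡⟨ R↦r ⟩
  r                               ∎

f[1+i,0]-nonZero : ∀ i → NonZero (f (suc i) 0)
f[1+i,0]-nonZero i = subst NonZero (begin
  mkℚ (cubeℤ (+ suc i)) 0 _   ≡⟨ toℚ≡mkℚ (cubeℤ (+ suc i)) ⟨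
  toℚ (cubeℤ (+ suc i))       ≡⟨ cong toℚ (fℤ-[i,0] (+ suc i)) ⟨
  toℚ (fℤ (+ suc i) 0ℤ)       ≡⟨ toℚ-fℤ (suc i) 0 ⟩
  f (suc i) 0                 ∎) _

ℚ-ring : AlmostCommutativeRing 0ℓ 0ℓ
ℚ-ring = fromCommutativeRing ℚP.+-*-commutativeRing (λ _ → nothing)

*-cancelˡ-≡ : ∀ p .{{_ : NonZero p}} {x y} → p * x ≡ p * y → x ≡ y
*-cancelˡ-≡ p {x} {y} eq = begin
  x                ≡⟨ ℚP.*-identityˡ x ⟨
  1ℚ * x           ≡⟨ cong (_* x) (ℚP.*-inverseˡ p) ⟨
  1/ p * p * x     ≡⟨ ℚP.*-assoc (1/ p) p x ⟩
  1/ p * (p * x)   ≡⟨ cong (1/ p *_) eq ⟩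
  1/ p * (p * y)   ≡⟨ ℚP.*-assoc (1/ p) p y ⟨
  1/ p * p * y     ≡⟨ cong (_* y) (ℚP.*-inverseˡ p) ⟩
  1ℚ * y           ≡⟨ ℚP.*-identityˡ y ⟩
  y                ∎

eliminate : ∀ F P f₁ g₁ g₂ A B C {u x y z} .{{_ : NonZero F}} →
            A * F + B * P ≡ f₁ → C * F + B * g₂ ≡ g₁ →
            F * u ≡ f₁ * x + g₁ * z → F * y ≡ P * x + g₂ * z →
            u ≡ A * x + B * y + C * z
eliminate F P f₁ g₁ g₂ A B C {u} {x} {y} {z} e₁ e₂ eq₁ eq₂ = *-cancelˡ-≡ F (begin
  F * u                                        ≡⟨ eq₁ ⟩
  f₁ * x + g₁ * z                              ≡⟨ cong₂ (λ s t → s * x + t * z) e₁ e₂ ⟨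
  (A * F + B * P) * x + (C * F + B * g₂) * z   ≡⟨ RingSolver.solve (F ∷ P ∷ g₂ ∷ A ∷ B ∷ C ∷ x ∷ z ∷ []) ℚ-ring ⟩
  F * (A * x + C * z) + B * (P * x + g₂ * z)   ≡⟨ cong (λ t → F * (A * x + C * z) + B * t) eq₂ ⟨
  F * (A * x + C * z) + B * (F * y)            ≡⟨ RingSolver.solve (F ∷ A ∷ B ∷ C ∷ x ∷ y ∷ z ∷ []) ℚ-ring ⟩
  F * (A * x + B * y + C * z)                  ∎)

recurrence : ∀ i j → ∃[ a ] ∃[ b ] ∃[ c ] (∀ (u : ℕ → ℕ → ℚ) → Solves u →
               u (suc i) (suc j) ≡ toℚ a * u i (suc j) + toℚ b * u (suc i) j + toℚ c * u i j)
recurrence i j =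
  let (a , b , c , e₁ , e₂) = eliminationCoefficients (suc i) (suc j)
      I = + suc i
      J = + suc j
  in a , b , c , λ u sol →
    eliminate (f (suc i) 0) (f 0 (suc j)) (f (suc i) (suc j)) (g 0 (suc j)) (g (suc i) (suc j))
              (toℚ a) (toℚ b) (toℚ c) {{f[1+i,0]-nonZero i}}
      (toℚ-combination a b (fℤ I 0ℤ) (fℤ 0ℤ J) (fℤ I J)
        (toℚ-fℤ (suc i) 0) (toℚ-fℤ 0 (suc j)) (toℚ-fℤ (suc i) (suc j)) e₁)
      (toℚ-combination c b (fℤ I 0ℤ) (gℤ I J) (gℤ 0ℤ J)
        (toℚ-fℤ (suc i) 0) (toℚ-gℤ (suc i) (suc j)) (toℚ-gℤ 0 (suc j)) e₂)
      (proj₁ (sol i j)) (proj₂ (sol i j))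

isInteger-+ : ∀ {x y} → IsInteger x → IsInteger y → IsInteger (x + y)
isInteger-+ (a , refl) (b , refl) = a ℤ.+ b , sym (toℚ-+ a b)

isInteger-* : ∀ {x y} → IsInteger x → IsInteger y → IsInteger (x * y)
isInteger-* (a , refl) (b , refl) = a ℤ.* b , sym (toℚ-* a b)

toℚ-isInteger : ∀ z → IsInteger (toℚ z)
toℚ-isInteger z = z , refl

ι-* : ∀ m n → ι (m ℕ.* n) ≡ ι m * ι n
ι-* m n = trans (cong toℚ (ℤP.pos-* m n)) (toℚ-* (+ m) (+ n))

ι*1/ι : ∀ m .{{_ : ℕ.NonZero m}} → ι m * (+ 1 / m) ≡ 1ℚ
ι*1/ι (suc m) =
  trans (cong₂ _*_ (toℚ≡mkℚ (+ suc m)) (ℚP.↥p/↧p≡p (mkℚ (+ 1) m (1-coprimeTo _))))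
        (ℚP.*-inverseʳ (mkℚ (+ suc m) 0 (Coprimality.sym (1-coprimeTo _))))

∣⇒isInteger-rescale : ∀ {m n} x → m ∣ n → IsInteger (ι m * x) → IsInteger (ι n * x)
∣⇒isInteger-rescale {m} x (divides k refl) mx-isInteger =
  subst IsInteger (sym (trans (cong (_* x) (ι-* k m)) (ℚP.*-assoc (ι k) (ι m) x)))
    (isInteger-* (toℚ-isInteger (+ k)) mx-isInteger)

∣⇒isInteger-quotient : ∀ {m n} .{{_ : ℕ.NonZero m}} → m ∣ n → IsInteger (ι n * (+ 1 / m))
∣⇒isInteger-quotient {m} (divides k refl) = + k , (begin
  ι (k ℕ.* m) * (+ 1 / m)   ≡⟨ cong (_* (+ 1 / m)) (ι-* k m) ⟩
  ι k * ι m * (+ 1 / m)     ≡⟨ ℚP.*-assoc (ι k) (ι m) (+ 1 / m) ⟩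
  ι k * (ι m * (+ 1 / m))   ≡⟨ cong (ι k *_) (ι*1/ι m) ⟩
  ι k * 1ℚ                  ≡⟨ ℚP.*-identityʳ (ι k) ⟩
  ι k                       ∎)

^-monoˡ-∣ : ∀ {m n} k → m ∣ n → m ^ k ∣ n ^ k
^-monoˡ-∣ zero    m∣n = ∣-refl
^-monoˡ-∣ (suc k) m∣n = *-pres-∣ m∣n (^-monoˡ-∣ k m∣n)

∣-chain⇒monotone : ∀ (s : ℕ → ℕ) → (∀ n → s n ∣ s (suc n)) → ∀ {m n} → m ≤ n → s m ∣ s n
∣-chain⇒monotone s step m≤n = go (≤⇒≤′ m≤n)
  where
  go : ∀ {m n} → m ≤′ n → s m ∣ s n
  go ≤′-refl        = ∣-refl
  go (≤′-step m≤′n) = ∣-trans (go m≤′n) (step _)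

d[n]∣d[1+n] : ∀ n → d n ∣ d (suc n)
d[n]∣d[1+n] n = n∣lcm[m,n] (suc n) (d n)

d³*H3-isInteger : ∀ n → IsInteger (ι (d n ^ 3) * H3 n)
d³*H3-isInteger zero    = 0ℤ , ℚP.*-zeroʳ (ι 1)
d³*H3-isInteger (suc n) =
  subst IsInteger (sym (ℚP.*-distribˡ-+ (ι (d (suc n) ^ 3)) (H3 n) (+ 1 / suc n ^ 3)))
    (isInteger-+ (∣⇒isInteger-rescale (H3 n) (^-monoˡ-∣ 3 (d[n]∣d[1+n] n)) (d³*H3-isInteger n))
                 (∣⇒isInteger-quotient (^-monoˡ-∣ 3 (m∣lcm[m,n] (suc n) (d n)))))

scaled-combination-isInteger : ∀ a b c S {x y z} → IsInteger (S * x) → IsInteger (S * y) → IsInteger (S * z) →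
                               IsInteger (S * (toℚ a * x + toℚ b * y + toℚ c * z))
scaled-combination-isInteger a b c S {x} {y} {z} Sx Sy Sz =
  subst IsInteger (sym (distribute (toℚ a) (toℚ b) (toℚ c) S x y z))
    (isInteger-+ (isInteger-+ (isInteger-* (toℚ-isInteger a) Sx) (isInteger-* (toℚ-isInteger b) Sy))
                 (isInteger-* (toℚ-isInteger c) Sz))
  where
  distribute : ∀ A B C S x y z → S * (A * x + B * y + C * z) ≡ A * (S * x) + B * (S * y) + C * (S * z)
  distribute = RingSolver.solve-∀ ℚ-ring

scaled-solution-isInteger : ∀ (s : ℕ → ℕ) → (∀ n → s n ∣ s (suc n)) → ∀ {u} → Solves u →
                            (∀ n → IsInteger (ι (s n) * u 0 n)) → (∀ n → IsInteger (ι (s n) * u n 0)) →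
                            ∀ i j → IsInteger (ι (s (i ⊔ j)) * u i j)
scaled-solution-isInteger s step sol left bottom zero    j       = left j
scaled-solution-isInteger s step sol left bottom (suc i) zero    = bottom (suc i)
scaled-solution-isInteger s step {u} sol left bottom (suc i) (suc j) =
  let (a , b , c , rec) = recurrence i j in
  subst (λ t → IsInteger (S * t)) (sym (rec u sol))
    (scaled-combination-isInteger a b c S
      (rescale (⊔-mono-≤ (n≤1+n i) ≤-refl) (induction i (suc j)))
      (rescale (⊔-mono-≤ ≤-refl (n≤1+n j)) (induction (suc i) j))
      (rescale (n≤1+n (i ⊔ j)) (induction i j)))
  where
  S = ι (s (suc (i ⊔ j)))
  induction = scaled-solution-isInteger s step sol left bottom
  rescale : ∀ {k l} → k ⊔ l ≤ suc (i ⊔ j) → IsInteger (ι (s (k ⊔ l)) * u k l) → IsInteger (S * u k l)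
  rescale le = ∣⇒isInteger-rescale _ (∣-chain⇒monotone s step le)

q-isInteger : ∀ (q : ℕ → ℕ → ℚ) → Solves q → (∀ j → q 0 j ≡ 1ℚ) → (∀ i → q i 0 ≡ 1ℚ) →
              ∀ i j → IsInteger (q i j)
q-isInteger q sol q₀ⱼ qᵢ₀ i j =
  subst IsInteger (ℚP.*-identityˡ (q i j))
    (scaled-solution-isInteger (λ _ → 1) (λ _ → ∣-refl) sol (one-isInteger q₀ⱼ) (one-isInteger qᵢ₀) i j)
  where
  one-isInteger : ∀ {v : ℕ → ℚ} → (∀ n → v n ≡ 1ℚ) → ∀ n → IsInteger (ι 1 * v n)
  one-isInteger v≡1 n = subst (λ t → IsInteger (ι 1 * t)) (sym (v≡1 n)) (toℚ-isInteger (+ 1))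

d³p-isInteger : ∀ (p : ℕ → ℕ → ℚ) → Solves p → p 0 0 ≡ 0ℚ →
                (∀ j → p 0 (suc j) ≡ H3 (suc j)) → (∀ i → p (suc i) 0 ≡ H3 (suc i)) →
                ∀ i j → IsInteger (ι (d (i ⊔ j) ^ 3) * p i j)
d³p-isInteger p sol p₀₀ p₀ⱼ pᵢ₀ =
  scaled-solution-isInteger (λ n → d n ^ 3) (λ n → ^-monoˡ-∣ 3 (d[n]∣d[1+n] n)) sol
    (boundary-isInteger (p 0) p₀₀ p₀ⱼ) (boundary-isInteger (λ n → p n 0) p₀₀ pᵢ₀)
  where
  boundary-isInteger : ∀ (v : ℕ → ℚ) → v 0 ≡ 0ℚ → (∀ n → v (suc n) ≡ H3 (suc n)) →
                       ∀ n → IsInteger (ι (d n ^ 3) * v n)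
  boundary-isInteger v v₀ vₙ n = subst (λ t → IsInteger (ι (d n ^ 3) * t)) (sym (v≡H3 n)) (d³*H3-isInteger n)
    where
    v≡H3 : ∀ n → v n ≡ H3 n
    v≡H3 zero    = v₀
    v≡H3 (suc n) = vₙ n

proposition2 :
    (∀ i j → ∃[ a ] ∃[ b ] ∃[ c ] (∀ (u : ℕ → ℕ → ℚ) → Solves u →
        u (suc i) (suc j) ≡ (a / 1) * u i (suc j) + (b / 1) * u (suc i) j + (c / 1) * u i j))
    × (∀ (q : ℕ → ℕ → ℚ) → Solves q → (∀ j → q 0 j ≡ 1ℚ) → (∀ i → q i 0 ≡ 1ℚ) →
        ∀ i j → IsInteger (q i j))
    × (∀ (p : ℕ → ℕ → ℚ) → Solves p → p 0 0 ≡ 0ℚ →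
        (∀ j → p 0 (suc j) ≡ H3 (suc j)) → (∀ i → p (suc i) 0 ≡ H3 (suc i)) →
        ∀ i j → IsInteger (ι (d (i ⊔ j) ^ 3) * p i j))
proposition2 = recurrence , q-isInteger , d³p-isInteger
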